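{- Let $D=(S,N,H,I,O)$ be a valid diagram and let $0\le n\le N-2$. If $D$ admits a right exchange at height $n$, then the right exchange $D_{R,n}$ is a valid diagram. If $D$ admits a left exchange at height $n$, then the left exchange $D_{L,n}$ is a valid diagram.
   Context: A diagram is a tuple $D=(S,N,H,I,O)$ with $S,N\in\mathbb N$ and functions $H,I,O:\{0,\dots,N-1\}\to\mathbb N$. Put $\Delta(n)=O(n)-I(n)$, $W(0)=S$ and $W(n+1)=W(n)+\Delta(n)$ for $n<N$. $D$ is valid if $W(n)\ge H(n)+I(n)$ for all $n\in\{0,\dots,N-1\}$. For $0\le n\le N-2$: $D$ admits a right exchange at height $n$ if $H(n+1)\ge H(n)+O(n)$, and then $D_{R,n}$ is the diagram identical to $D$ except that $H(n)$ is replaced by $H(n+1)-\Delta(n)$, $I(n)$ by $I(n+1)$, $O(n)$ by $O(n+1)$, $H(n+1)$ by $H(n)$, $I(n+1)$ by $I(n)$, $O(n+1)$ by $O(n)$. $D$ admits a left exchange at height $n$ if $H(n)\ge H(n+1)+I(n+1)$, and then $D_{L,n}$ is identical to $D$ except that $H(n)$ is replaced by $H(n+1)$, $I(n)$ by $I(n+1)$, $O(n)$ by $O(n+1)$, $H(n+1)$ by $H(n)+\Delta(n+1)$, $I(n+1)$ by $I(n)$, $O(n+1)$ by $O(n)$. -}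

module Defs where

open import Data.Nat using (ℕ; zero; suc; _+_; _∸_; _≤_; _<_)
open import Data.Integer as ℤ using (ℤ; +_)
open import Data.Nat.Properties using (_≟_)
open import Relation.Nullary using (yes; no)

-- A diagram D = (S, N, H, I, O).  H, I, O are given as functions ℕ → ℕ;
-- only their values on {0, …, N-1} are ever consulted.
record Diagram : Set where
  constructor mkDiagram
  field
    S : ℕ
    N : ℕ
    H I O : ℕ → ℕ
open Diagram public

Δ : Diagram → ℕ → ℤ
Δ D n = (+ O D n) ℤ.- (+ I D n)

W : Diagram → ℕ → ℤ
W D zero    = + S D
W D (suc n) = W D n ℤ.+ Δ D n

Valid : Diagram → Set
Valid D = ∀ n → n < N D → + (H D n + I D n) ℤ.≤ W D n

AdmitsRight : Diagram → ℕ → Set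
AdmitsRight D n = H D n + O D n ≤ H D (suc n)

AdmitsLeft : Diagram → ℕ → Set
AdmitsLeft D n = H D (suc n) + I D (suc n) ≤ H D n

update2 : (ℕ → ℕ) → ℕ → ℕ → ℕ → (ℕ → ℕ)
update2 f n a b m with m ≟ n
... | yes _ = a
... | no _ with m ≟ suc n
...   | yes _ = b
...   | no _  = f m

-- Right exchange D_{R,n}.  New H(n) = H(n+1) - Δ(n) = (H(n+1) + I(n)) ∸ O(n);
-- under AdmitsRight this truncated subtraction is exact (H(n+1) ≥ O(n)).
rightExchange : Diagram → ℕ → Diagram
rightExchange D n = mkDiagram (S D) (N D)
  (update2 (H D) n ((H D (suc n) + I D n) ∸ O D n) (H D n))
  (update2 (I D) n (I D (suc n)) (I D n))
  (update2 (O D) n (O D (suc n)) (O D n))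

-- Left exchange D_{L,n}.  New H(n+1) = H(n) + Δ(n+1) = (H(n) + O(n+1)) ∸ I(n+1);
-- under AdmitsLeft this truncated subtraction is exact (H(n) ≥ I(n+1)).
leftExchange : Diagram → ℕ → Diagram
leftExchange D n = mkDiagram (S D) (N D)
  (update2 (H D) n (H D (suc n)) ((H D n + O D (suc n)) ∸ I D (suc n)))
  (update2 (I D) n (I D (suc n)) (I D n))
  (update2 (O D) n (O D (suc n)) (O D n))

-- Both exchanges are instances of one operation, `exchange D n a b`: the
-- in/out data of rows n and n+1 are swapped and these rows get the new
-- heights a and b, while all other rows are untouched.  Swapping two adjacent
-- increments changes the running widths W at a single place: W(m) is
-- unchanged for m ≠ n+1, and the new W(n+1) is W(n) + Δ(n+1) instead of
-- W(n) + Δ(n).  Hence validity of the exchanged diagram reduces to two local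
-- inequalities, one for row n and one for row n+1 (`exchange-valid`).
module Submission where

open import Defs
open import Data.Nat as ℕ using (ℕ; zero; suc; _+_; _∸_; _≤_; _<_)
import Data.Nat.Properties as ℕ
open import Data.Integer as ℤ using (ℤ; +_; _-_; _⊖_; 0ℤ)
open import Data.Integer.Properties as ℤ
  using (m-n≡m⊖n; ⊖-≥; +-monoˡ-≤; +-monoʳ-≤; module ≤-Reasoning)
open import Algebra.Properties.CommutativeSemigroup ℤ.+-commutativeSemigroup
  using (xy∙z≈xz∙y)
open import Data.Integer.Tactic.RingSolver using (solve; solve-∀)
open import Data.List using (_∷_; [])
open import Data.Product using (_×_; _,_)
open import Data.Empty using (⊥-elim)
open import Relation.Binary.PropositionalEquality
open import Relation.Nullary using (yes; no)
open import Function using (_∘_)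

update2-at : ∀ f n a b → update2 f n a b n ≡ a
update2-at f n a b with n ℕ.≟ n
... | yes _   = refl
... | no n≢n = ⊥-elim (n≢n refl)

update2-next : ∀ f n a b → update2 f n a b (suc n) ≡ b
update2-next f n a b with suc n ℕ.≟ n
... | yes 1+n≡n = ⊥-elim (ℕ.1+n≢n 1+n≡n)
... | no _ with suc n ℕ.≟ suc n
...   | yes _       = refl
...   | no 1+n≢1+n = ⊥-elim (1+n≢1+n refl)

update2-other : ∀ f n a b {m} → m ≢ n → m ≢ suc n → update2 f n a b m ≡ f m
update2-other f n a b {m} m≢n m≢1+n with m ℕ.≟ n
... | yes m≡n = ⊥-elim (m≢n m≡n)
... | no _ with m ℕ.≟ suc n
...   | yes m≡1+n = ⊥-elim (m≢1+n m≡1+n)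
...   | no _      = refl

data Position (n : ℕ) : ℕ → Set where
  at    : Position n n
  next  : Position n (suc n)
  other : ∀ {m} → m ≢ n → m ≢ suc n → Position n m

position : ∀ n m → Position n m
position n m with m ℕ.≟ n
... | yes refl = at
... | no m≢n with m ℕ.≟ suc n
...   | yes refl  = next
...   | no m≢1+n = other m≢n m≢1+n

-- Both D_{R,n} and D_{L,n} are of this form
-- (definitionally), for suitable a and b.
exchange : Diagram → ℕ → ℕ → ℕ → Diagram
exchange D n a b = mkDiagram (S D) (N D)
  (update2 (H D) n a b)
  (update2 (I D) n (I D (suc n)) (I D n))
  (update2 (O D) n (O D (suc n)) (O D n))

bound-along : ∀ {h h′ i i′ : ℕ} {w w′ : ℤ} → h ≡ h′ → i ≡ i′ → w ≡ w′ →
  + (h′ + i′) ℤ.≤ w′ → + (h + i) ℤ.≤ w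
bound-along refl refl refl h′+i′≤w′ = h′+i′≤w′

module Exchange (D : Diagram) (n : ℕ) (a b : ℕ) where

  private
    E : Diagram
    E = exchange D n a b

    n≢1+n : n ≢ suc n
    n≢1+n = ℕ.1+n≢n ∘ sym

  Δ-at : Δ E n ≡ Δ D (suc n)
  Δ-at = cong₂ (λ o i → + o - + i) (update2-at (O D) n _ _) (update2-at (I D) n _ _)

  Δ-next : Δ E (suc n) ≡ Δ D n
  Δ-next = cong₂ (λ o i → + o - + i) (update2-next (O D) n _ _) (update2-next (I D) n _ _)

  Δ-other : ∀ {m} → m ≢ n → m ≢ suc n → Δ E m ≡ Δ D m
  Δ-other m≢n m≢1+n =
    cong₂ (λ o i → + o - + i) (update2-other (O D) n _ _ m≢n m≢1+n) (update2-other (I D) n _ _ m≢n m≢1+n)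

  -- Swapping two adjacent increments leaves every partial sum unchanged
  -- except the one that contains exactly one of them.
  W-other : ∀ m → m ≢ suc n → W E m ≡ W D m
  W-other zero _ = refl
  W-other (suc m) 1+m≢1+n with position n m
  ... | at = ⊥-elim (1+m≢1+n refl)
  ... | next = begin
    (W E n ℤ.+ Δ E n) ℤ.+ Δ E (suc n)            ≡⟨ cong₂ (λ w d → (w ℤ.+ Δ E n) ℤ.+ d) (W-other n n≢1+n) Δ-next ⟩
    (W D n ℤ.+ Δ E n) ℤ.+ Δ D n                  ≡⟨ cong (λ d → (W D n ℤ.+ d) ℤ.+ Δ D n) Δ-at ⟩
    (W D n ℤ.+ Δ D (suc n)) ℤ.+ Δ D n            ≡⟨ xy∙z≈xz∙y (W D n) (Δ D (suc n)) (Δ D n) ⟩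
    (W D n ℤ.+ Δ D n) ℤ.+ Δ D (suc n)            ∎
    where open ≡-Reasoning
  ... | other m≢n m≢1+n = cong₂ ℤ._+_ (W-other m m≢1+n) (Δ-other m≢n m≢1+n)

  W-next : W E (suc n) ≡ W D n ℤ.+ Δ D (suc n)
  W-next = cong₂ ℤ._+_ (W-other n n≢1+n) Δ-at

  exchange-valid : Valid D →
    + a ℤ.+ + I D (suc n) ℤ.≤ W D n →
    + b ℤ.+ + I D n ℤ.≤ W D n ℤ.+ Δ D (suc n) →
    Valid (exchange D n a b)
  exchange-valid V row-n row-1+n m m<N with position n m
  ... | at = bound-along (update2-at (H D) n a b) (update2-at (I D) n _ _) (W-other n n≢1+n) row-n
  ... | next = bound-along (update2-next (H D) n a b) (update2-next (I D) n _ _) W-next row-1+n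
  ... | other m≢n m≢1+n =
    bound-along (update2-other (H D) n a b m≢n m≢1+n) (update2-other (I D) n _ _ m≢n m≢1+n)
                (W-other m m≢1+n) (V m m<N)

-- A truncated difference (a + b) ∸ c with c ≤ a
-- loses nothing, so the heights of D_{R,n} and D_{L,n} are exactly
-- H(n+1) - Δ(n) and H(n) + Δ(n+1), as in the definition of the exchanges.
-- (Note that + a ℤ.+ + b computes to + (a + b), which is used silently here
-- and below to pass between natural and integer sums.)

∸-exact : ∀ a b c → c ≤ a → + ((a + b) ∸ c) ≡ (+ a ℤ.+ + b) - + c
∸-exact a b c c≤a = begin
  + ((a + b) ∸ c)   ≡⟨ ⊖-≥ (ℕ.≤-trans c≤a (ℕ.m≤m+n a b)) ⟨
  (a + b) ⊖ c       ≡⟨ m-n≡m⊖n (a + b) c ⟨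
  (+ a ℤ.+ + b) - + c ∎
  where open ≡-Reasoning

right-height : ∀ {h i o} → o ≤ h → + ((h + i) ∸ o) ≡ + h - (+ o - + i)
right-height {h} {i} {o} o≤h = trans (∸-exact h i o o≤h) (shuffle (+ h) (+ i) (+ o))
  where
  shuffle : ∀ x y z → (x ℤ.+ y) - z ≡ x - (z - y)
  shuffle = solve-∀

left-height : ∀ {h o i} → i ≤ h → + ((h + o) ∸ i) ≡ + h ℤ.+ (+ o - + i)
left-height {h} {o} {i} i≤h = trans (∸-exact h o i i≤h) (ℤ.+-assoc (+ h) (+ o) (ℤ.- + i))

-- The four local inequalities, over the integers.  Throughout, w is the width
-- W(n), and (hₖ, iₖ, oₖ) are height, in- and out-degree of row n+k of D.

≤-move : ∀ x y d → x ℤ.≤ y ℤ.+ d → x - d ℤ.≤ y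
≤-move x y d x≤y+d = begin
  x - d           ≤⟨ +-monoˡ-≤ (ℤ.- d) x≤y+d ⟩
  (y ℤ.+ d) - d   ≡⟨ solve (y ∷ d ∷ []) ⟩
  y               ∎
  where open ≤-Reasoning

right-row-n : ∀ h₁ i₁ w d → h₁ ℤ.+ i₁ ℤ.≤ w ℤ.+ d → (h₁ - d) ℤ.+ i₁ ℤ.≤ w
right-row-n h₁ i₁ w d valid₁ = begin
  (h₁ - d) ℤ.+ i₁   ≡⟨ solve (h₁ ∷ i₁ ∷ d ∷ []) ⟩
  (h₁ ℤ.+ i₁) - d   ≤⟨ ≤-move (h₁ ℤ.+ i₁) w d valid₁ ⟩
  w                 ∎
  where open ≤-Reasoning

right-row-next : ∀ h₀ i₀ o₀ h₁ i₁ o₁ w →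
  h₀ ℤ.+ o₀ ℤ.≤ h₁ → h₁ ℤ.+ i₁ ℤ.≤ w ℤ.+ (o₀ - i₀) → 0ℤ ℤ.≤ o₁ →
  h₀ ℤ.+ i₀ ℤ.≤ w ℤ.+ (o₁ - i₁)
right-row-next h₀ i₀ o₀ h₁ i₁ o₁ w admits valid₁ 0≤o₁ = begin
  h₀ ℤ.+ i₀                                ≡⟨ solve (h₀ ∷ i₀ ∷ o₀ ∷ i₁ ∷ []) ⟩
  (((h₀ ℤ.+ o₀) ℤ.+ i₁) - (o₀ - i₀)) - i₁  ≤⟨ +-monoˡ-≤ (ℤ.- i₁) (+-monoˡ-≤ (ℤ.- (o₀ - i₀)) (+-monoˡ-≤ i₁ admits)) ⟩
  ((h₁ ℤ.+ i₁) - (o₀ - i₀)) - i₁           ≤⟨ +-monoˡ-≤ (ℤ.- i₁) (≤-move (h₁ ℤ.+ i₁) w (o₀ - i₀) valid₁) ⟩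
  w - i₁                                   ≡⟨ ℤ.+-identityʳ (w - i₁) ⟨
  (w - i₁) ℤ.+ 0ℤ                          ≤⟨ +-monoʳ-≤ (w - i₁) 0≤o₁ ⟩
  (w - i₁) ℤ.+ o₁                          ≡⟨ solve (w ∷ i₁ ∷ o₁ ∷ []) ⟩
  w ℤ.+ (o₁ - i₁)                          ∎
  where open ≤-Reasoning

left-row-n : ∀ h₀ i₀ h₁ i₁ w →
  h₁ ℤ.+ i₁ ℤ.≤ h₀ → h₀ ℤ.+ i₀ ℤ.≤ w → 0ℤ ℤ.≤ i₀ → h₁ ℤ.+ i₁ ℤ.≤ w
left-row-n h₀ i₀ h₁ i₁ w admits valid₀ 0≤i₀ = begin
  h₁ ℤ.+ i₁    ≤⟨ admits ⟩
  h₀           ≡⟨ ℤ.+-identityʳ h₀ ⟨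
  h₀ ℤ.+ 0ℤ    ≤⟨ +-monoʳ-≤ h₀ 0≤i₀ ⟩
  h₀ ℤ.+ i₀    ≤⟨ valid₀ ⟩
  w            ∎
  where open ≤-Reasoning

left-row-next : ∀ h₀ i₀ w d → h₀ ℤ.+ i₀ ℤ.≤ w → (h₀ ℤ.+ d) ℤ.+ i₀ ℤ.≤ w ℤ.+ d
left-row-next h₀ i₀ w d valid₀ = begin
  (h₀ ℤ.+ d) ℤ.+ i₀   ≡⟨ xy∙z≈xz∙y h₀ d i₀ ⟩
  (h₀ ℤ.+ i₀) ℤ.+ d   ≤⟨ +-monoˡ-≤ d valid₀ ⟩
  w ℤ.+ d             ∎
  where open ≤-Reasoning

lemma15 : (D : Diagram) → Valid D → (n : ℕ) → n + 2 ≤ N D →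
    (AdmitsRight D n → Valid (rightExchange D n)) ×
    (AdmitsLeft D n → Valid (leftExchange D n))
lemma15 D V n n+2≤N = right , left
  where
  open Exchange D n using (exchange-valid)

  h₀ i₀ o₀ h₁ i₁ o₁ w : ℤ
  h₀ = + H D n
  i₀ = + I D n
  o₀ = + O D n
  h₁ = + H D (suc n)
  i₁ = + I D (suc n)
  o₁ = + O D (suc n)
  w  = W D n

  1+n<N : suc n < N D
  1+n<N = subst (_≤ N D) (ℕ.+-comm n 2) n+2≤N

  valid₀ : h₀ ℤ.+ i₀ ℤ.≤ w
  valid₀ = V n (ℕ.<-trans (ℕ.n<1+n n) 1+n<N)

  valid₁ : h₁ ℤ.+ i₁ ℤ.≤ w ℤ.+ (o₀ - i₀)
  valid₁ = V (suc n) 1+n<N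

  right : AdmitsRight D n → Valid (rightExchange D n)
  right admits = exchange-valid _ _ V
    (subst (λ h → h ℤ.+ i₁ ℤ.≤ w) (sym (right-height (ℕ.m+n≤o⇒n≤o (H D n) admits)))
           (right-row-n h₁ i₁ w (Δ D n) valid₁))
    (right-row-next h₀ i₀ o₀ h₁ i₁ o₁ w (ℤ.+≤+ admits) valid₁ (ℤ.+≤+ ℕ.z≤n))

  left : AdmitsLeft D n → Valid (leftExchange D n)
  left admits = exchange-valid _ _ V
    (left-row-n h₀ i₀ h₁ i₁ w (ℤ.+≤+ admits) valid₀ (ℤ.+≤+ ℕ.z≤n))
    (subst (λ h → h ℤ.+ i₀ ℤ.≤ w ℤ.+ Δ D (suc n)) (sym (left-height (ℕ.m+n≤o⇒n≤o (H D (suc n)) admits)))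
           (left-row-next h₀ i₀ w (Δ D (suc n)) valid₀))
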